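{- Let $\mathbf A$ be a residuated ortholattice and let ${\sim}x:=x\backslash 0$. The following are equivalent: (1) $\mathbf A$ is an orthomodular lattice; (2) $\mathbf A$ satisfies ${\sim}x\approx\neg x$; (3) $\mathbf A$ satisfies $x\approx{\sim}{\sim}x$.
   Context: A residuated ortholattice is an algebra $(A,\wedge,\vee,\neg,\backslash,0,1)$ where $(A,\wedge,\vee,0,1)$ is a bounded lattice, $\neg$ is an order-reversing involution, and $x\cdot y\le z\iff y\le x\backslash z$ for all $x,y,z$, where $x\cdot y:=x\wedge(\neg x\vee y)$. An orthomodular lattice is an ortholattice ($x\wedge\neg x\approx 0$) satisfying $x\le y\implies y\approx x\vee(y\wedge\neg x)$; here "$\mathbf A$ is an orthomodular lattice" refers to its $\{\wedge,\vee,\neg,0,1\}$-reduct. -}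

module Defs where

open import Level using (Level; suc)
open import Data.Product using (_×_)
open import Function.Bundles using (_⇔_)
open import Relation.Binary.PropositionalEquality using (_≡_)
open import Algebra.Core using (Op₁; Op₂)
open import Algebra.Lattice.Structures using (IsLattice)

record ResiduatedOrtholattice (a : Level) : Set (suc a) where
  infixr 6 _∨_
  infixr 7 _∧_
  infix 8 ¬_
  infix 8 ∼_
  infix 4 _≤_
  infixr 6 _\\_
  infixl 7 _·_
  field
    Carrier   : Set a
    _∧_ _∨_   : Op₂ Carrier
    ¬_        : Op₁ Carrier
    _\\_      : Op₂ Carrier
    ⊥ ⊤       : Carrier
    isLattice : IsLattice _≡_ _∨_ _∧_

  _≤_ : Carrier → Carrier → Set a
  x ≤ y = x ∧ y ≡ x

  _·_ : Op₂ Carrier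
  x · y = x ∧ (¬ x ∨ y)

  field
    ⊥-least    : ∀ x → ⊥ ≤ x
    ⊤-greatest : ∀ x → x ≤ ⊤
    ¬-involutive : ∀ x → ¬ (¬ x) ≡ x
    ¬-antitone   : ∀ x y → x ≤ y → ¬ y ≤ ¬ x
    residuated : ∀ x y z → (x · y ≤ z) ⇔ (y ≤ x \\ z)

  ∼_ : Op₁ Carrier
  ∼ x = x \\ ⊥

  IsOrtholattice : Set a
  IsOrtholattice = ∀ x → x ∧ ¬ x ≡ ⊥

  IsOrthomodular : Set a
  IsOrthomodular = IsOrtholattice × (∀ x y → x ≤ y → y ≡ x ∨ (y ∧ ¬ x))

{-# OPTIONS --safe #-}
module Submission where

-- Always ¬x ≤ ∼x, because x · ¬x = x ∧ ¬x = 0, while x ∧ (¬x ∨ ∼x) = x · ∼x = 0.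
-- Orthomodularity applied to ¬x ≤ ¬x ∨ ∼x therefore collapses that join to ¬x.
-- Conversely, once ∼ = ¬, residuation reads "x · y = 0 iff y ≤ ¬x", and with
-- w = x ∨ (y ∧ ¬x) the computation y · ¬w = y ∧ ¬w = 0 gives y ≤ w.
-- Finally, if ∼ is involutive then ∼(∼x ∧ ∼¬x) ≥ x ∨ ¬x = 1 forces ∼x ∧ ∼¬x = 0;
-- since ¬∼x ≤ x ≤ ∼¬x this meet is ∼x · ∼¬x, so ∼¬x ≤ ∼∼x = x, i.e. ∼¬x = x.

open import Defs
open import Level using (Level)
open import Data.Product using (_×_; _,_)
open import Function.Bundles using (_⇔_; mk⇔; Equivalence)
open import Relation.Binary.PropositionalEquality
  using (_≡_; sym; trans; cong; cong₂; subst; subst₂; isEquivalence)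
import Algebra.Lattice.Bundles as Algebraic
import Algebra.Lattice.Properties.Lattice as AlgebraicProperties
import Relation.Binary.Lattice as OrderTheoretic
import Relation.Binary.Lattice.Properties.JoinSemilattice as JoinProperties
import Relation.Binary.Lattice.Properties.MeetSemilattice as MeetProperties
import Relation.Binary.Reasoning.PartialOrder as PosetReasoning

module ResiduatedOrtholatticeProperties {a : Level} (A : ResiduatedOrtholattice a) where
  open ResiduatedOrtholattice A

  algebraicLattice : Algebraic.Lattice a a
  algebraicLattice = record { isLattice = isLattice }

  -- The library orders a lattice by x ≈ x ∧ y; the record uses x ∧ y ≡ x.
  orderTheoreticLattice : OrderTheoretic.Lattice a a a
  orderTheoreticLattice = record
    { _≤_       = _≤_
    ; isLattice = record
      { isPartialOrder = record
        { isPreorder = record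
          { isEquivalence = isEquivalence
          ; reflexive     = λ x≡y → sym (L.reflexive x≡y)
          ; trans         = λ x≤y y≤z → sym (L.trans (sym x≤y) (sym y≤z))
          }
        ; antisym = λ x≤y y≤x → L.antisym (sym x≤y) (sym y≤x)
        }
      ; supremum = λ x y → sym (L.x≤x∨y x y) , sym (L.y≤x∨y x y)
                         , λ z x≤z y≤z → sym (L.∨-least (sym x≤z) (sym y≤z))
      ; infimum  = λ x y → sym (L.x∧y≤x x y) , sym (L.x∧y≤y x y)
                         , λ z z≤x z≤y → sym (L.∧-greatest (sym z≤x) (sym z≤y))
      }
    }
    where
    module L = OrderTheoretic.Lattice (AlgebraicProperties.∨-∧-orderTheoreticLattice algebraicLattice)

  open OrderTheoretic.Lattice orderTheoreticLattice
    using (poset; x≤x∨y; y≤x∨y; ∨-least; x∧y≤x; x∧y≤y; ∧-greatest)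
    renaming (refl to ≤-refl; trans to ≤-trans; antisym to ≤-antisym; reflexive to ≤-reflexive)
  open JoinProperties (OrderTheoretic.Lattice.joinSemilattice orderTheoreticLattice)
    using (∨-monotonic; ∨-comm; x≤y⇒x∨y≈y)
  open MeetProperties (OrderTheoretic.Lattice.meetSemilattice orderTheoreticLattice)
    using (∧-monotonic; ∧-comm)
  open PosetReasoning poset

  ⊥-identityʳ : ∀ x → x ∨ ⊥ ≡ x
  ⊥-identityʳ x = trans (∨-comm x ⊥) (x≤y⇒x∨y≈y (⊥-least x))

  ≤⊥⇒≡⊥ : ∀ {x} → x ≤ ⊥ → x ≡ ⊥
  ≤⊥⇒≡⊥ {x} x≤⊥ = ≤-antisym x≤⊥ (⊥-least x)

  ¬-reflects-≤ : ∀ {x y} → ¬ x ≤ ¬ y → y ≤ x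
  ¬-reflects-≤ {x} {y} ¬x≤¬y = subst₂ _≤_ (¬-involutive y) (¬-involutive x) (¬-antitone _ _ ¬x≤¬y)

  ·≤⇒≤\\ : ∀ {x y z} → x · y ≤ z → y ≤ x \\ z
  ·≤⇒≤\\ {x} {y} {z} = Equivalence.to (residuated x y z)

  ≤\\⇒·≤ : ∀ {x y z} → y ≤ x \\ z → x · y ≤ z
  ≤\\⇒·≤ {x} {y} {z} = Equivalence.from (residuated x y z)

  ·≡∧ : ∀ {x y} → ¬ x ≤ y → x · y ≡ x ∧ y
  ·≡∧ {x} ¬x≤y = cong (x ∧_) (x≤y⇒x∨y≈y ¬x≤y)

  x∧¬x≡⊥ : IsOrtholattice
  x∧¬x≡⊥ x = ≤⊥⇒≡⊥ (begin
    x ∧ ¬ x  ≡⟨ cong (x ∧_) (⊥-identityʳ (¬ x)) ⟨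
    x · ⊥    ≤⟨ ≤\\⇒·≤ (⊥-least (∼ x)) ⟩
    ⊥        ∎)

  ⊤≤x∨¬x : ∀ x → ⊤ ≤ x ∨ ¬ x
  ⊤≤x∨¬x x = ¬-reflects-≤ (begin
    ¬ (x ∨ ¬ x)    ≤⟨ ∧-greatest (¬-antitone _ _ (x≤x∨y x (¬ x))) (¬-antitone _ _ (y≤x∨y x (¬ x))) ⟩
    ¬ x ∧ ¬ (¬ x)  ≡⟨ x∧¬x≡⊥ (¬ x) ⟩
    ⊥              ≤⟨ ⊥-least (¬ ⊤) ⟩
    ¬ ⊤            ∎)

  ¬x≤∼x : ∀ x → ¬ x ≤ ∼ x
  ¬x≤∼x x = ·≤⇒≤\\ (≤-reflexive (trans (·≡∧ ≤-refl) (x∧¬x≡⊥ x)))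

  x·∼x≤⊥ : ∀ x → x · ∼ x ≤ ⊥
  x·∼x≤⊥ x = ≤\\⇒·≤ ≤-refl

  ⊤≤∼x⇒x≤⊥ : ∀ {x} → ⊤ ≤ ∼ x → x ≤ ⊥
  ⊤≤∼x⇒x≤⊥ {x} ⊤≤∼x = begin
    x                ≤⟨ ∧-greatest ≤-refl (≤-trans (⊤-greatest x) (≤-trans ⊤≤∼x (y≤x∨y (¬ x) (∼ x)))) ⟩
    x ∧ (¬ x ∨ ∼ x)  ≤⟨ x·∼x≤⊥ x ⟩
    ⊥                ∎

  ∼-antitone : ∀ {x y} → x ≤ y → ∼ y ≤ ∼ x
  ∼-antitone {x} {y} x≤y = ·≤⇒≤\\ (begin
    x ∧ (¬ x ∨ ∼ y)  ≤⟨ ∧-greatest (x∧y≤x x _) (∧-monotonic x≤y (y≤x∨y (¬ y) _)) ⟩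
    x ∧ (y · u)      ≤⟨ ∧-monotonic ≤-refl (≤\\⇒·≤ (∨-least ¬x≤y\\y∧¬x ∼y≤y\\y∧¬x)) ⟩
    x ∧ (y ∧ ¬ x)    ≤⟨ ∧-monotonic ≤-refl (x∧y≤y y (¬ x)) ⟩
    x ∧ ¬ x          ≡⟨ x∧¬x≡⊥ x ⟩
    ⊥                ∎)
    where
    u : Carrier
    u = ¬ x ∨ ∼ y
    ¬x≤y\\y∧¬x : ¬ x ≤ y \\ (y ∧ ¬ x)
    ¬x≤y\\y∧¬x = ·≤⇒≤\\ (≤-reflexive (·≡∧ (¬-antitone x y x≤y)))
    ∼y≤y\\y∧¬x : ∼ y ≤ y \\ (y ∧ ¬ x)
    ∼y≤y\\y∧¬x = ·≤⇒≤\\ (≤-trans (x·∼x≤⊥ y) (⊥-least (y ∧ ¬ x)))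

  orthomodular⇒∼≡¬ : IsOrthomodular → ∀ x → ∼ x ≡ ¬ x
  orthomodular⇒∼≡¬ (_ , orthomodular) x = ≤-antisym ∼x≤¬x (¬x≤∼x x)
    where
    ∼x≤¬x : ∼ x ≤ ¬ x
    ∼x≤¬x = begin
      ∼ x                                ≤⟨ y≤x∨y (¬ x) (∼ x) ⟩
      ¬ x ∨ ∼ x                          ≡⟨ orthomodular (¬ x) (¬ x ∨ ∼ x) (x≤x∨y (¬ x) (∼ x)) ⟩
      ¬ x ∨ ((¬ x ∨ ∼ x) ∧ ¬ (¬ x))      ≡⟨ cong (λ u → ¬ x ∨ ((¬ x ∨ ∼ x) ∧ u)) (¬-involutive x) ⟩
      ¬ x ∨ ((¬ x ∨ ∼ x) ∧ x)            ≡⟨ cong (¬ x ∨_) (∧-comm (¬ x ∨ ∼ x) x) ⟩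
      ¬ x ∨ x · ∼ x                      ≤⟨ ∨-monotonic ≤-refl (x·∼x≤⊥ x) ⟩
      ¬ x ∨ ⊥                            ≡⟨ ⊥-identityʳ (¬ x) ⟩
      ¬ x                                ∎

  ∼≡¬⇒orthomodular : (∀ x → ∼ x ≡ ¬ x) → IsOrthomodular
  ∼≡¬⇒orthomodular ∼≡¬ = x∧¬x≡⊥ , orthomodular
    where
    orthomodular : ∀ x y → x ≤ y → y ≡ x ∨ (y ∧ ¬ x)
    orthomodular x y x≤y = ≤-antisym (¬-reflects-≤ ¬w≤¬y) w≤y
      where
      w : Carrier
      w = x ∨ (y ∧ ¬ x)
      w≤y : w ≤ y
      w≤y = ∨-least x≤y (x∧y≤x y (¬ x))
      y·¬w≤⊥ : y · ¬ w ≤ ⊥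
      y·¬w≤⊥ = begin
        y · ¬ w                      ≡⟨ ·≡∧ (¬-antitone w y w≤y) ⟩
        y ∧ ¬ w                      ≤⟨ ∧-greatest (∧-monotonic ≤-refl (¬-antitone _ _ (x≤x∨y x (y ∧ ¬ x))))
                                                   (≤-trans (x∧y≤y y (¬ w)) (¬-antitone _ _ (y≤x∨y x (y ∧ ¬ x)))) ⟩
        (y ∧ ¬ x) ∧ ¬ (y ∧ ¬ x)      ≡⟨ x∧¬x≡⊥ (y ∧ ¬ x) ⟩
        ⊥                            ∎
      ¬w≤¬y : ¬ w ≤ ¬ y
      ¬w≤¬y = subst (¬ w ≤_) (∼≡¬ y) (·≤⇒≤\\ y·¬w≤⊥)

  ∼≡¬⇒∼-involutive : (∀ x → ∼ x ≡ ¬ x) → ∀ x → x ≡ ∼ (∼ x)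
  ∼≡¬⇒∼-involutive ∼≡¬ x = sym (trans (cong ∼_ (∼≡¬ x)) (trans (∼≡¬ (¬ x)) (¬-involutive x)))

  module _ (∼-involutive : ∀ x → x ≡ ∼ (∼ x)) where

    ∼x∧∼¬x≤⊥ : ∀ x → ∼ x ∧ ∼ (¬ x) ≤ ⊥
    ∼x∧∼¬x≤⊥ x = ⊤≤∼x⇒x≤⊥ (begin
      ⊤                          ≤⟨ ⊤≤x∨¬x x ⟩
      x ∨ ¬ x                    ≡⟨ cong₂ _∨_ (∼-involutive x) (∼-involutive (¬ x)) ⟩
      ∼ (∼ x) ∨ ∼ (∼ (¬ x))      ≤⟨ ∨-least (∼-antitone (x∧y≤x _ _)) (∼-antitone (x∧y≤y _ _)) ⟩
      ∼ (∼ x ∧ ∼ (¬ x))          ∎)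

    ∼¬x≡x : ∀ x → ∼ (¬ x) ≡ x
    ∼¬x≡x x = ≤-antisym ∼¬x≤x x≤∼¬x
      where
      x≤∼¬x : x ≤ ∼ (¬ x)
      x≤∼¬x = begin
        x            ≡⟨ ¬-involutive x ⟨
        ¬ (¬ x)      ≤⟨ ¬x≤∼x (¬ x) ⟩
        ∼ (¬ x)      ∎
      ¬∼x≤∼¬x : ¬ (∼ x) ≤ ∼ (¬ x)
      ¬∼x≤∼¬x = begin
        ¬ (∼ x)      ≤⟨ ¬x≤∼x (∼ x) ⟩
        ∼ (∼ x)      ≡⟨ ∼-involutive x ⟨
        x            ≤⟨ x≤∼¬x ⟩
        ∼ (¬ x)      ∎
      ∼¬x≤x : ∼ (¬ x) ≤ x
      ∼¬x≤x = subst (∼ (¬ x) ≤_) (sym (∼-involutive x)) (·≤⇒≤\\ (begin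
        ∼ x · ∼ (¬ x)   ≡⟨ ·≡∧ ¬∼x≤∼¬x ⟩
        ∼ x ∧ ∼ (¬ x)   ≤⟨ ∼x∧∼¬x≤⊥ x ⟩
        ⊥               ∎))

    ∼-involutive⇒∼≡¬ : ∀ x → ∼ x ≡ ¬ x
    ∼-involutive⇒∼≡¬ x = trans (cong ∼_ (sym (¬-involutive x))) (∼¬x≡x (¬ x))

lemma4p3 : ∀ {a : Level} (A : ResiduatedOrtholattice a) →
    let open ResiduatedOrtholattice A in
    (IsOrthomodular ⇔ (∀ x → ∼ x ≡ ¬ x)) × ((∀ x → ∼ x ≡ ¬ x) ⇔ (∀ x → x ≡ ∼ (∼ x)))
lemma4p3 A =
  mk⇔ orthomodular⇒∼≡¬ ∼≡¬⇒orthomodular ,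
  mk⇔ ∼≡¬⇒∼-involutive ∼-involutive⇒∼≡¬
  where open ResiduatedOrtholatticeProperties A
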